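{- Let $N$ be a positive integer with base-$\varphi$ representation $N=\sum_{k=R}^{L} d_k\varphi^k$, where $\varphi=\frac{1+\sqrt5}{2}$, $R\le 0\le L$ are integers, each $d_k\in\{0,1\}$, and $d_kd_{k+1}=0$ for all $k$. Then \[2N = d_LL_L+d_{L-1}L_{L-1}+\dots+d_1L_1+2d_0 + d_R(-1)^{ -R}L_{ -R}+\dots+d_{ -1}(-1)^{1}L_1,\] i.e. $2N=\sum_{k=1}^{L}d_kL_k+2d_0+\sum_{k=R}^{ -1}d_k(-1)^{ -k}L_{ -k}$, where $L_n$ denotes the $n$-th Lucas number.
   Context: The Lucas numbers are defined by $L_0=2$, $L_1=1$, $L_n=L_{n-1}+L_{n-2}$. A base-$\varphi$ representation of $N$ is an expression $N=\sum_{k=R}^{L}d_k\varphi^k$ with digits $d_k\in\{0,1\}$, no two consecutive digits equal to $1$, and $R\le 0\le L$; every positive integer has a unique such representation (up to leading/trailing zeros). -}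

module Defs where

open import Data.Nat as ℕ using (ℕ; zero; suc)
open import Data.Integer as ℤ using (ℤ; +_; -[1+_]; ∣_∣)

lucas : ℕ → ℕ
lucas zero = 2
lucas (suc zero) = 1
lucas (suc (suc n)) = lucas (suc n) ℕ.+ lucas n

neg1^ : ℕ → ℤ
neg1^ zero = + 1
neg1^ (suc n) = ℤ.- neg1^ n

-- The ring ℤ[φ] = { a + b φ : a b ∈ ℤ }, φ = (1+√5)/2.
-- Since 1, φ are linearly independent over ℚ (φ irrational), a + bφ is
-- represented faithfully by the pair (a , b), and equality is equality of pairs.
record ℤφ : Set where
  constructor _+_φ
  field
    re : ℤ
    im : ℤ

_⊕_ : ℤφ → ℤφ → ℤφ
(a + b φ) ⊕ (c + d φ) = (a ℤ.+ c) + (b ℤ.+ d) φ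

_⊙_ : ℕ → ℤφ → ℤφ
n ⊙ (a + b φ) = (+ n ℤ.* a) + (+ n ℤ.* b) φ

zeroφ : ℤφ
zeroφ = (+ 0) + (+ 0) φ

ι : ℤ → ℤφ
ι a = a + (+ 0) φ

-- multiplication by φ:   (a + bφ)φ = b + (a+b)φ      (using φ² = φ + 1)
mulφ : ℤφ → ℤφ
mulφ (a + b φ) = b + (a ℤ.+ b) φ

-- multiplication by φ⁻¹ = φ - 1:   (a + bφ)(φ - 1) = (b - a) + aφ
divφ : ℤφ → ℤφ
divφ (a + b φ) = (b ℤ.- a) + a φ

iter : (ℤφ → ℤφ) → ℕ → ℤφ → ℤφ
iter f zero x = x
iter f (suc n) x = f (iter f n x)

φ^ : ℤ → ℤφ
φ^ (+ n) = iter mulφ n (ι (+ 1))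
φ^ (-[1+ n ]) = iter divφ (suc n) (ι (+ 1))

sumFrom : {A : Set} → (A → A → A) → A → ℤ → ℕ → (ℤ → A) → A
sumFrom _∙_ e a zero f = e
sumFrom _∙_ e a (suc n) f = f a ∙ sumFrom _∙_ e (a ℤ.+ + 1) n f

Σφ : ℤ → ℤ → (ℤ → ℤφ) → ℤφ
Σφ lo hi f = sumFrom _⊕_ zeroφ lo ∣ (hi ℤ.+ + 1) ℤ.- lo ∣ f

-- Σ_{k=lo}^{hi} f k in ℤ  (for lo ≤ hi + 1)
Σℤ : ℤ → ℤ → (ℤ → ℤ) → ℤ
Σℤ lo hi f = sumFrom ℤ._+_ (+ 0) lo ∣ (hi ℤ.+ + 1) ℤ.- lo ∣ f

-- The trace of ℚ(√5) maps a + bφ to (a + bφ) + (a + bψ) = 2a + b, where ψ = 1 − φ = −φ⁻¹ is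
-- the conjugate of φ. It is additive, it is 2N on the integer N, and it sends φᵏ to
-- φᵏ + ψᵏ = Lₖ and φ⁻ᵏ to ψ⁻ᵏ + φ⁻ᵏ = (−1)ᵏ (φᵏ + ψᵏ) = (−1)ᵏ Lₖ. Taking the trace of the
-- base-φ representation therefore gives the formula.
module Submission where

open import Defs
open import Data.Nat as ℕ using (ℕ; zero; suc; s≤s; z≤n)
import Data.Nat.Properties as ℕ
open import Data.Integer as ℤ using (ℤ; +_; -[1+_]; ∣_∣)
open import Data.Integer.Properties as ℤ
  using (+-assoc; +-identityˡ; +-identityʳ; *-assoc; ≤-refl; ≤-trans)
open import Data.Integer.Tactic.RingSolver using (solve-∀)
open import Function using (_∘_)
open import Relation.Binary.PropositionalEquality
  using (_≡_; refl; sym; trans; cong; cong₂; subst; module ≡-Reasoning)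
open ≡-Reasoning

sumFrom-map : {A B : Set} {_∙_ : A → A → A} {ε : A} {_∘′_ : B → B → B} {ε′ : B}
  (h : A → B) → (∀ x y → h (x ∙ y) ≡ h x ∘′ h y) → h ε ≡ ε′ →
  ∀ a n (f : ℤ → A) → h (sumFrom _∙_ ε a n f) ≡ sumFrom _∘′_ ε′ a n (h ∘ f)
sumFrom-map h h-∙ h-ε a zero    f = h-ε
sumFrom-map {_∘′_ = _∘′_} h h-∙ h-ε a (suc n) f =
  trans (h-∙ (f a) _) (cong (h (f a) ∘′_) (sumFrom-map h h-∙ h-ε (a ℤ.+ + 1) n f))

sumFrom-cong : {A : Set} (_∙_ : A → A → A) (ε : A) (a : ℤ) (n : ℕ) {f g : ℤ → A} →
  (∀ k → a ℤ.≤ k → k ℤ.< a ℤ.+ + n → f k ≡ g k) →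
  sumFrom _∙_ ε a n f ≡ sumFrom _∙_ ε a n g
sumFrom-cong _∙_ ε a zero    f≡g = refl
sumFrom-cong _∙_ ε a (suc n) f≡g =
  cong₂ _∙_ (f≡g a ≤-refl a<a+1+n) (sumFrom-cong _∙_ ε (a ℤ.+ + 1) n f≡g′)
  where
  a<a+1+n : a ℤ.< a ℤ.+ + suc n
  a<a+1+n = subst (ℤ._< a ℤ.+ + suc n) (+-identityʳ a) (ℤ.+-monoʳ-< a (ℤ.+<+ (s≤s z≤n)))
  f≡g′ : ∀ k → a ℤ.+ + 1 ℤ.≤ k → k ℤ.< a ℤ.+ + 1 ℤ.+ + n → _
  f≡g′ k a+1≤k k<a+1+n =
    f≡g k (≤-trans (ℤ.i≤i+j a (+ 1)) a+1≤k) (subst (λ z → k ℤ.< z) (+-assoc a (+ 1) (+ n)) k<a+1+n)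

sumFrom-+ : ∀ a m n (f : ℤ → ℤ) →
  sumFrom ℤ._+_ (+ 0) a (m ℕ.+ n) f ≡
  sumFrom ℤ._+_ (+ 0) a m f ℤ.+ sumFrom ℤ._+_ (+ 0) (a ℤ.+ + m) n f
sumFrom-+ a zero n f = begin
  sumFrom ℤ._+_ (+ 0) a n f                   ≡⟨ cong (λ b → sumFrom ℤ._+_ (+ 0) b n f) (+-identityʳ a) ⟨
  sumFrom ℤ._+_ (+ 0) (a ℤ.+ + 0) n f         ≡⟨ +-identityˡ _ ⟨
  + 0 ℤ.+ sumFrom ℤ._+_ (+ 0) (a ℤ.+ + 0) n f ∎
sumFrom-+ a (suc m) n f = begin
  f a ℤ.+ sumFrom ℤ._+_ (+ 0) (a ℤ.+ + 1) (m ℕ.+ n) f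
    ≡⟨ cong (λ z → f a ℤ.+ z) (sumFrom-+ (a ℤ.+ + 1) m n f) ⟩
  f a ℤ.+ (S (a ℤ.+ + 1) m ℤ.+ S (a ℤ.+ + 1 ℤ.+ + m) n)
    ≡⟨ +-assoc (f a) _ _ ⟨
  f a ℤ.+ S (a ℤ.+ + 1) m ℤ.+ S (a ℤ.+ + 1 ℤ.+ + m) n
    ≡⟨ cong (λ b → f a ℤ.+ S (a ℤ.+ + 1) m ℤ.+ S b n) (+-assoc a (+ 1) (+ m)) ⟩
  f a ℤ.+ S (a ℤ.+ + 1) m ℤ.+ S (a ℤ.+ + suc m) n ∎
  where
  S : ℤ → ℕ → ℤ
  S b k = sumFrom ℤ._+_ (+ 0) b k f

i≤j⇒+∣j-i∣≡j-i : ∀ {i j} → i ℤ.≤ j → + ∣ j ℤ.- i ∣ ≡ j ℤ.- i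
i≤j⇒+∣j-i∣≡j-i = ℤ.0≤i⇒+∣i∣≡i ∘ ℤ.i≤j⇒0≤j-i

i≤j⇒i+∣j-i∣≡j : ∀ {i j} → i ℤ.≤ j → i ℤ.+ + ∣ j ℤ.- i ∣ ≡ j
i≤j⇒i+∣j-i∣≡j {i} {j} i≤j = trans (cong (λ z → i ℤ.+ z) (i≤j⇒+∣j-i∣≡j-i i≤j)) (i+[j-i]≡j i j)
  where
  i+[j-i]≡j : ∀ i j → i ℤ.+ (j ℤ.- i) ≡ j
  i+[j-i]≡j = solve-∀

Σℤ-cong : ∀ lo hi {f g : ℤ → ℤ} → lo ℤ.≤ hi ℤ.+ + 1 →
  (∀ k → lo ℤ.≤ k → k ℤ.< hi ℤ.+ + 1 → f k ≡ g k) → Σℤ lo hi f ≡ Σℤ lo hi g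
Σℤ-cong lo hi lo≤hi+1 f≡g = sumFrom-cong ℤ._+_ (+ 0) lo _
  (λ k lo≤k k<end → f≡g k lo≤k (subst (λ z → k ℤ.< z) (i≤j⇒i+∣j-i∣≡j lo≤hi+1) k<end))

Σℤ-split : ∀ lo mid hi (f : ℤ → ℤ) → lo ℤ.≤ mid ℤ.+ + 1 → mid ℤ.≤ hi →
  Σℤ lo hi f ≡ Σℤ lo mid f ℤ.+ Σℤ (mid ℤ.+ + 1) hi f
Σℤ-split lo mid hi f lo≤mid+1 mid≤hi = begin
  sumFrom ℤ._+_ (+ 0) lo (∣ (hi ℤ.+ + 1) ℤ.- lo ∣) f
    ≡⟨ cong (λ n → sumFrom ℤ._+_ (+ 0) lo n f) length-+ ⟩
  sumFrom ℤ._+_ (+ 0) lo (∣ m ℤ.- lo ∣ ℕ.+ ∣ (hi ℤ.+ + 1) ℤ.- m ∣) f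
    ≡⟨ sumFrom-+ lo ∣ m ℤ.- lo ∣ ∣ (hi ℤ.+ + 1) ℤ.- m ∣ f ⟩
  Σℤ lo mid f ℤ.+ sumFrom ℤ._+_ (+ 0) (lo ℤ.+ + ∣ m ℤ.- lo ∣) (∣ (hi ℤ.+ + 1) ℤ.- m ∣) f
    ≡⟨ cong (λ b → Σℤ lo mid f ℤ.+ sumFrom ℤ._+_ (+ 0) b (∣ (hi ℤ.+ + 1) ℤ.- m ∣) f)
            (i≤j⇒i+∣j-i∣≡j lo≤mid+1) ⟩
  Σℤ lo mid f ℤ.+ Σℤ m hi f ∎
  where
  m = mid ℤ.+ + 1
  m≤hi+1 : m ℤ.≤ hi ℤ.+ + 1
  m≤hi+1 = ℤ.+-monoˡ-≤ (+ 1) mid≤hi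
  length-+ : ∣ (hi ℤ.+ + 1) ℤ.- lo ∣ ≡ ∣ m ℤ.- lo ∣ ℕ.+ ∣ (hi ℤ.+ + 1) ℤ.- m ∣
  length-+ = ℤ.+-injective (begin
    + ∣ (hi ℤ.+ + 1) ℤ.- lo ∣               ≡⟨ i≤j⇒+∣j-i∣≡j-i (≤-trans lo≤mid+1 m≤hi+1) ⟩
    (hi ℤ.+ + 1) ℤ.- lo                     ≡⟨ telescope lo m (hi ℤ.+ + 1) ⟩
    (m ℤ.- lo) ℤ.+ ((hi ℤ.+ + 1) ℤ.- m)     ≡⟨ cong₂ ℤ._+_ (i≤j⇒+∣j-i∣≡j-i lo≤mid+1) (i≤j⇒+∣j-i∣≡j-i m≤hi+1) ⟨
    + ∣ m ℤ.- lo ∣ ℤ.+ + ∣ (hi ℤ.+ + 1) ℤ.- m ∣ ∎)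
    where
    telescope : ∀ a b c → c ℤ.- a ≡ (b ℤ.- a) ℤ.+ (c ℤ.- b)
    telescope = solve-∀

trace : ℤφ → ℤ
trace (a + b φ) = a ℤ.+ a ℤ.+ b

trace-⊕ : ∀ x y → trace (x ⊕ y) ≡ trace x ℤ.+ trace y
trace-⊕ (a + b φ) (c + d φ) = lemma a b c d
  where
  lemma : ∀ a b c d → (a ℤ.+ c) ℤ.+ (a ℤ.+ c) ℤ.+ (b ℤ.+ d) ≡ (a ℤ.+ a ℤ.+ b) ℤ.+ (c ℤ.+ c ℤ.+ d)
  lemma = solve-∀

trace-⊙ : ∀ n x → trace (n ⊙ x) ≡ + n ℤ.* trace x
trace-⊙ n (a + b φ) = lemma (+ n) a b
  where
  lemma : ∀ n a b → n ℤ.* a ℤ.+ n ℤ.* a ℤ.+ n ℤ.* b ≡ n ℤ.* (a ℤ.+ a ℤ.+ b)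
  lemma = solve-∀

trace-ι : ∀ n → trace (ι (+ n)) ≡ + (2 ℕ.* n)
trace-ι n = cong +_ (ℕ.+-assoc n n 0)

trace-Σφ : ∀ lo hi (f : ℤ → ℤφ) → trace (Σφ lo hi f) ≡ Σℤ lo hi (trace ∘ f)
trace-Σφ lo hi = sumFrom-map trace trace-⊕ refl lo ∣ (hi ℤ.+ + 1) ℤ.- lo ∣

trace-mulφ² : ∀ y → trace (mulφ (mulφ y)) ≡ trace y ℤ.+ trace (mulφ y)
trace-mulφ² (a + b φ) = lemma a b
  where
  lemma : ∀ a b → (a ℤ.+ b) ℤ.+ (a ℤ.+ b) ℤ.+ (b ℤ.+ (a ℤ.+ b)) ≡
                  (a ℤ.+ a ℤ.+ b) ℤ.+ (b ℤ.+ b ℤ.+ (a ℤ.+ b))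
  lemma = solve-∀

trace-divφ² : ∀ y → trace (divφ (divφ y)) ≡ trace y ℤ.- trace (divφ y)
trace-divφ² (a + b φ) = lemma a b
  where
  lemma : ∀ a b → (a ℤ.- (b ℤ.- a)) ℤ.+ (a ℤ.- (b ℤ.- a)) ℤ.+ (b ℤ.- a) ≡
                  (a ℤ.+ a ℤ.+ b) ℤ.- ((b ℤ.- a) ℤ.+ (b ℤ.- a) ℤ.+ a)
  lemma = solve-∀

trace-mulφ^ : ∀ n → trace (iter mulφ n (ι (+ 1))) ≡ + lucas n
trace-mulφ^ zero          = refl
trace-mulφ^ (suc zero)    = refl
trace-mulφ^ (suc (suc n)) = begin
  trace (mulφ (mulφ y))                  ≡⟨ trace-mulφ² y ⟩
  trace y ℤ.+ trace (mulφ y)             ≡⟨ cong₂ ℤ._+_ (trace-mulφ^ n) (trace-mulφ^ (suc n)) ⟩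
  + (lucas n ℕ.+ lucas (suc n))          ≡⟨ cong +_ (ℕ.+-comm (lucas n) (lucas (suc n))) ⟩
  + lucas (suc (suc n))                  ∎
  where
  y = iter mulφ n (ι (+ 1))

trace-divφ^ : ∀ n → trace (iter divφ n (ι (+ 1))) ≡ neg1^ n ℤ.* + lucas n
trace-divφ^ zero          = refl
trace-divφ^ (suc zero)    = refl
trace-divφ^ (suc (suc n)) = begin
  trace (divφ (divφ y))                  ≡⟨ trace-divφ² y ⟩
  trace y ℤ.- trace (divφ y)             ≡⟨ cong₂ ℤ._-_ (trace-divφ^ n) (trace-divφ^ (suc n)) ⟩
  s ℤ.* q ℤ.- ℤ.- s ℤ.* p                ≡⟨ lemma s p q ⟩
  ℤ.- (ℤ.- s) ℤ.* (p ℤ.+ q)              ∎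
  where
  y = iter divφ n (ι (+ 1))
  s = neg1^ n
  p = + lucas (suc n)
  q = + lucas n
  lemma : ∀ s p q → s ℤ.* q ℤ.- ℤ.- s ℤ.* p ≡ ℤ.- (ℤ.- s) ℤ.* (p ℤ.+ q)
  lemma = solve-∀

trace-φ^-nonneg : ∀ {k} → + 0 ℤ.≤ k → trace (φ^ k) ≡ + lucas ∣ k ∣
trace-φ^-nonneg {+ n} _ = trace-mulφ^ n

trace-φ^-neg : ∀ {k} → k ℤ.< + 0 → trace (φ^ k) ≡ neg1^ ∣ k ∣ ℤ.* + lucas ∣ k ∣
trace-φ^-neg { -[1+ n ]} _ = trace-divφ^ (suc n)
trace-φ^-neg {+ _} (ℤ.+<+ ())

trace-⊙φ^-nonneg : ∀ n {k} → + 0 ℤ.≤ k → trace (n ⊙ φ^ k) ≡ + n ℤ.* + lucas ∣ k ∣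
trace-⊙φ^-nonneg n {k} 0≤k = trans (trace-⊙ n (φ^ k)) (cong (λ z → + n ℤ.* z) (trace-φ^-nonneg 0≤k))

trace-⊙φ^-neg : ∀ n {k} → k ℤ.< + 0 → trace (n ⊙ φ^ k) ≡ + n ℤ.* neg1^ ∣ k ∣ ℤ.* + lucas ∣ k ∣
trace-⊙φ^-neg n {k} k<0 = trans (trace-⊙ n (φ^ k))
  (trans (cong (λ z → + n ℤ.* z) (trace-φ^-neg k<0)) (sym (*-assoc (+ n) _ _)))

trace-⊙φ^0 : ∀ n → trace (n ⊙ φ^ (+ 0)) ≡ + (2 ℕ.* n)
trace-⊙φ^0 n = trans (trace-⊙ n (φ^ (+ 0))) (trans (sym (ℤ.pos-* n 2)) (cong +_ (ℕ.*-comm n 2)))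

corollary1 : (N : ℕ) → 0 ℕ.< N →
    (R L : ℤ) → R ℤ.≤ + 0 → + 0 ℤ.≤ L →
    (d : ℤ → ℕ) →
    (∀ k → R ℤ.≤ k → k ℤ.≤ L → d k ℕ.≤ 1) →
    (∀ k → R ℤ.≤ k → k ℤ.< L → d k ℕ.* d (k ℤ.+ + 1) ≡ 0) →
    Σφ R L (λ k → d k ⊙ φ^ k) ≡ ι (+ N) →
    + (2 ℕ.* N) ≡
      (Σℤ (+ 1) L (λ k → + d k ℤ.* + lucas ∣ k ∣)
        ℤ.+ + (2 ℕ.* d (+ 0))
        ℤ.+ Σℤ R (ℤ.- + 1) (λ k → + d k ℤ.* neg1^ ∣ k ∣ ℤ.* + lucas ∣ k ∣))
corollary1 N _ R L R≤0 0≤L d _ _ repr = begin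
  + (2 ℕ.* N)                                          ≡⟨ trace-ι N ⟨
  trace (ι (+ N))                                      ≡⟨ cong trace repr ⟨
  trace (Σφ R L (λ k → d k ⊙ φ^ k))                    ≡⟨ trace-Σφ R L (λ k → d k ⊙ φ^ k) ⟩
  Σℤ R L t                                             ≡⟨ Σℤ-split R (ℤ.- + 1) L t R≤0 (≤-trans ℤ.-≤+ 0≤L) ⟩
  Σℤ R (ℤ.- + 1) t ℤ.+ Σℤ (+ 0) L t
    ≡⟨ cong (λ z → Σℤ R (ℤ.- + 1) t ℤ.+ z) (Σℤ-split (+ 0) (+ 0) L t (ℤ.+≤+ z≤n) 0≤L) ⟩
  Σℤ R (ℤ.- + 1) t ℤ.+ (t (+ 0) ℤ.+ + 0 ℤ.+ Σℤ (+ 1) L t)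
    ≡⟨ cong₂ ℤ._+_
         (Σℤ-cong R (ℤ.- + 1) R≤0 (λ k _ k<0 → trace-⊙φ^-neg (d k) k<0))
         (cong₂ (λ x y → x ℤ.+ + 0 ℤ.+ y) (trace-⊙φ^0 (d (+ 0)))
           (Σℤ-cong (+ 1) L (ℤ.+-monoˡ-≤ (+ 1) 0≤L)
             (λ k 1≤k _ → trace-⊙φ^-nonneg (d k) (≤-trans (ℤ.+≤+ z≤n) 1≤k)))) ⟩
  Σℤ R (ℤ.- + 1) negative ℤ.+ (+ (2 ℕ.* d (+ 0)) ℤ.+ + 0 ℤ.+ Σℤ (+ 1) L positive)
    ≡⟨ rearrange (Σℤ R (ℤ.- + 1) negative) (+ (2 ℕ.* d (+ 0))) (Σℤ (+ 1) L positive) ⟩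
  Σℤ (+ 1) L positive ℤ.+ + (2 ℕ.* d (+ 0)) ℤ.+ Σℤ R (ℤ.- + 1) negative ∎
  where
  t positive negative : ℤ → ℤ
  t k = trace (d k ⊙ φ^ k)
  positive k = + d k ℤ.* + lucas ∣ k ∣
  negative k = + d k ℤ.* neg1^ ∣ k ∣ ℤ.* + lucas ∣ k ∣
  rearrange : ∀ a b c → a ℤ.+ (b ℤ.+ + 0 ℤ.+ c) ≡ c ℤ.+ b ℤ.+ a
  rearrange = solve-∀
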